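{- Let $0<i_1<\cdots<i_L$ and $0<j_1<\cdots<j_M<k_1<\cdots<k_N$ be integers. Then $$\left(2^{2^{i_1}}+\cdots+2^{2^{i_L}}\right)^2\neq\left(2^{2^{j_1}}+\cdots+2^{2^{j_M}}\right)^2+\left(2^{2^{k_1}}+\cdots+2^{2^{k_N}}\right)^2.$$
   Context: Here $L,M,N$ are positive integers. -}

module Defs where

open import Data.Nat using (ℕ; _+_; _^_; _<_)
open import Data.Fin using (Fin)
open import Data.Vec.Functional using (Vector; foldr)

StrictlyIncreasing : ∀ {n} → (Fin n → ℕ) → Set
StrictlyIncreasing {n} a = ∀ (s t : Fin n) → s Data.Fin.< t → a s < a t

fermatSum : ∀ {n} → (Fin n → ℕ) → ℕ
fermatSum a = foldr _+_ 0 (λ t → 2 ^ (2 ^ a t))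

module Submission where

-- Write A, B, C for the three sums, so the claim is A² ≠ B² + C².
-- Every term 2^(2^e) with e ≥ 1 is divisible by 4, hence so are A and C
-- (for C because k₁ > j₁ > 0).  Two multiples of 4 satisfy A ≤ C or A ≥ C + 4.
-- On the other hand B is a sum of distinct powers 2^(2^jₛ) whose exponents are
-- all at most 2^(k₁-1), so the binary-expansion bound gives B < 2^(2^(k₁-1)+1),
-- i.e. B² < 4·2^(2^k₁) ≤ 4C.  Finally no A can then satisfy A² = B² + C² with
-- B > 0: if A ≤ C then A² ≤ C² < B² + C², and if A ≥ C + 4 then
-- A² ≥ C² + 8C + 16 > C² + 4C > C² + B².

open import Defs
open import Data.Nat using (ℕ; zero; suc; _+_; _*_; _∸_; _<_; _≤_; _^_; z≤n; s≤s)
open import Data.Nat.Properties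
open import Data.Nat.Divisibility using (_∣_; divides; ∣m∣n⇒∣m+n)
open import Data.Nat.Solver using (module +-*-Solver)
open +-*-Solver using (solve; _:=_; _:+_; _:*_; _:^_; con)
open import Data.Fin using (Fin)
import Data.Fin as F
open import Data.Vec.Functional using (foldr)
open import Relation.Nullary using (yes; no)
open import Data.Sum using (_⊎_; inj₁; inj₂)
open import Relation.Binary.PropositionalEquality
  using (_≢_; _≡_; refl; sym; cong; subst; module ≡-Reasoning)

∣-foldr-+ : ∀ {n} d (f : Fin n → ℕ) → (∀ t → d ∣ f t) → d ∣ foldr _+_ 0 f
∣-foldr-+ {zero}  d f d∣f = divides 0 refl
∣-foldr-+ {suc n} d f d∣f =
  ∣m∣n⇒∣m+n (d∣f F.zero) (∣-foldr-+ d (λ t → f (F.suc t)) (λ t → d∣f (F.suc t)))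

^-∣-^ : ∀ x {m n} → m ≤ n → x ^ m ∣ x ^ n
^-∣-^ x {m} {n} m≤n = divides (x ^ (n ∸ m)) (begin
  x ^ n            ≡⟨ cong (x ^_) (sym (m∸n+n≡m m≤n)) ⟩
  x ^ (n ∸ m + m)  ≡⟨ ^-distribˡ-+-* x (n ∸ m) m ⟩
  x ^ (n ∸ m) * x ^ m ∎)
  where open ≡-Reasoning

4∣2^2^e : ∀ e → 0 < e → 4 ∣ 2 ^ (2 ^ e)
4∣2^2^e e e>0 = ^-∣-^ 2 (^-monoʳ-≤ 2 e>0)

4∣fermatSum : ∀ {n} (a : Fin n → ℕ) → (∀ t → 0 < a t) → 4 ∣ fermatSum a
4∣fermatSum a pos = ∣-foldr-+ 4 (λ t → 2 ^ (2 ^ a t)) (λ t → 4∣2^2^e (a t) (pos t))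

-- The extra 2^c makes the induction go through: adding the
-- smallest term 2^(f 0) ≥ 2^c turns the slack 2^c into 2^(f 0 + 1).
sumPow2+2^c≤2^b : ∀ {n} (f : Fin n → ℕ) → StrictlyIncreasing f → ∀ c b → c ≤ b →
  (∀ t → c ≤ f t) → (∀ t → f t < b) → foldr _+_ 0 (λ t → 2 ^ f t) + 2 ^ c ≤ 2 ^ b
sumPow2+2^c≤2^b {zero} f inc c b c≤b lo hi = ^-monoʳ-≤ 2 c≤b
sumPow2+2^c≤2^b {suc n} f inc c b c≤b lo hi = begin
    (2^f₀ + rest) + 2 ^ c  ≤⟨ +-monoʳ-≤ (2^f₀ + rest) (^-monoʳ-≤ 2 (lo F.zero)) ⟩
    (2^f₀ + rest) + 2^f₀   ≡⟨ solve 2 (λ x y → (x :+ y) :+ x := y :+ (x :+ (x :+ con 0))) refl 2^f₀ rest ⟩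
    rest + 2 ^ suc (f F.zero) ≤⟨ sumPow2+2^c≤2^b (λ t → f (F.suc t))
                                   (λ s t s<t → inc (F.suc s) (F.suc t) (s≤s s<t))
                                   (suc (f F.zero)) b (hi F.zero)
                                   (λ t → inc F.zero (F.suc t) (s≤s z≤n)) (λ t → hi (F.suc t)) ⟩
    2 ^ b ∎
  where
  open ≤-Reasoning
  2^f₀ = 2 ^ f F.zero
  rest = foldr _+_ 0 (λ t → 2 ^ f (F.suc t))

sumPow2<2^b : ∀ {n} (f : Fin n → ℕ) → StrictlyIncreasing f → ∀ b →
  (∀ t → f t < b) → foldr _+_ 0 (λ t → 2 ^ f t) < 2 ^ b
sumPow2<2^b f inc b hi =
  subst (_≤ 2 ^ b) (+-comm _ 1) (sumPow2+2^c≤2^b f inc 0 b z≤n (λ _ → z≤n) hi)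

-- The square of a Fermat-type sum with all exponents below e ≥ 1 is smaller
-- than 4·2^(2^e): its exponents 2^(jₜ) are distinct and at most 2^(e-1), so the
-- sum is below 2^(2^(e-1)+1), whose square is 2^(2^e + 2).
fermatSum²<4*2^2^e : ∀ {n} (j : Fin n → ℕ) → StrictlyIncreasing j → ∀ e → 0 < e →
  (∀ t → j t < e) → fermatSum j ^ 2 < 4 * 2 ^ (2 ^ e)
fermatSum²<4*2^2^e j inc (suc e) _ below = begin-strict
  fermatSum j ^ 2          <⟨ ^-monoˡ-< 2 (sumPow2<2^b (λ t → 2 ^ j t) pow-inc b pow-below) ⟩
  (2 ^ b) ^ 2              ≡⟨ ^-*-assoc 2 b 2 ⟩
  2 ^ (b * 2)              ≡⟨ cong (2 ^_) (solve 1 (λ y → (con 1 :+ y) :* con 2 := con 2 :+ con 2 :* y) refl (2 ^ e)) ⟩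
  2 ^ (2 + 2 ^ suc e)      ≡⟨ ^-distribˡ-+-* 2 2 (2 ^ suc e) ⟩
  4 * 2 ^ (2 ^ suc e)      ∎
  where
  open ≤-Reasoning
  b = suc (2 ^ e)
  pow-inc : StrictlyIncreasing (λ t → 2 ^ j t)
  pow-inc s t s<t = ^-monoʳ-< 2 (s≤s (s≤s z≤n)) (inc s t s<t)
  pow-below : ∀ t → 2 ^ j t < b
  pow-below t = s≤s (^-monoʳ-≤ 2 (≤-pred (below t)))

multiples-gap : ∀ d A C → d ∣ A → d ∣ C → A ≤ C ⊎ C + d ≤ A
multiples-gap d _ _ (divides a refl) (divides c refl) with a ≤? c
... | yes a≤c = inj₁ (*-monoˡ-≤ d a≤c)
... | no  a≰c = inj₂ (subst (_≤ a * d) (+-comm d (c * d)) (*-monoˡ-≤ d (≰⇒> a≰c)))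

no-square-in-gap : ∀ A B C → 0 < B → B ^ 2 < 4 * C → A ≤ C ⊎ C + 4 ≤ A →
  A ^ 2 ≢ B ^ 2 + C ^ 2
no-square-in-gap A B C B>0 B²<4C (inj₁ A≤C) eq = <-irrefl refl (begin-strict
  C ^ 2          <⟨ +-monoˡ-< (C ^ 2) (^-monoˡ-< 2 B>0) ⟩
  B ^ 2 + C ^ 2  ≡⟨ sym eq ⟩
  A ^ 2          ≤⟨ ^-monoˡ-≤ 2 A≤C ⟩
  C ^ 2          ∎)
  where open ≤-Reasoning
no-square-in-gap A B C B>0 B²<4C (inj₂ C+4≤A) eq = <-irrefl refl (begin-strict
  B ^ 2 + C ^ 2                   <⟨ +-monoˡ-< (C ^ 2) B²<4C ⟩
  4 * C + C ^ 2                   ≤⟨ m≤m+n _ _ ⟩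
  (4 * C + C ^ 2) + (4 * C + 16)  ≡⟨ solve 1 (λ c → (con 4 :* c :+ c :^ 2) :+ (con 4 :* c :+ con 16)
                                                  := (c :+ con 4) :^ 2) refl C ⟩
  (C + 4) ^ 2                     ≤⟨ ^-monoˡ-≤ 2 C+4≤A ⟩
  A ^ 2                           ≡⟨ eq ⟩
  B ^ 2 + C ^ 2                   ∎)
  where open ≤-Reasoning

mainTheorem18 : (L M N : ℕ) → 0 < L → 0 < M → 0 < N →
    (i : Fin L → ℕ) → (j : Fin M → ℕ) → (k : Fin N → ℕ) →
    (∀ t → 0 < i t) → StrictlyIncreasing i →
    (∀ t → 0 < j t) → StrictlyIncreasing j → StrictlyIncreasing k →
    (∀ s t → j s < k t) →
    fermatSum i ^ 2 ≢ fermatSum j ^ 2 + fermatSum k ^ 2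
mainTheorem18 L (suc M) (suc N) _ _ _ i j k i>0 _ j>0 j-inc _ j<k =
  no-square-in-gap (fermatSum i) (fermatSum j) (fermatSum k) B>0 B²<4C
    (multiples-gap 4 (fermatSum i) (fermatSum k) (4∣fermatSum i i>0) (4∣fermatSum k k>0))
  where
  open ≤-Reasoning
  k>0 : ∀ t → 0 < k t
  k>0 t = <-trans (j>0 F.zero) (j<k F.zero t)
  B>0 : 0 < fermatSum j
  B>0 = <-≤-trans (m^n>0 2 (2 ^ j F.zero)) (m≤m+n _ _)
  -- B² < 4·2^(2^k₁), and 2^(2^k₁) is the first term of C
  B²<4C : fermatSum j ^ 2 < 4 * fermatSum k
  B²<4C = begin-strict
    fermatSum j ^ 2          <⟨ fermatSum²<4*2^2^e j j-inc (k F.zero) (k>0 F.zero) (λ t → j<k t F.zero) ⟩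
    4 * 2 ^ (2 ^ k F.zero)   ≤⟨ *-monoʳ-≤ 4 (m≤m+n (2 ^ (2 ^ k F.zero)) _) ⟩
    4 * fermatSum k          ∎
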